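{- Let $p\geq 7$ be a prime and let $M$ be the $p\times p$ tridiagonal matrix with $M_{1,1}=M_{p,p}=p-1$, $M_{i,i}=p-2$ for $2\leq i\leq p-1$, $M_{i,i+1}=M_{i+1,i}=1$ for $1\leq i\leq p-1$, and all other entries $0$. Let $x_1,\dots,x_p$ be non-negative integers satisfying $M(x_1,\ldots,x_p)^t\leq (p-1)!\,\mathbf{1}$ entrywise, where $\mathbf{1}$ is the all-ones column vector, and let $x_{\max}=\max\{x_i\mid i=1,\dots,p\}$. Then: (1) $|\{i\in[p]\mid x_i\leq \frac{(p-1)!}{p}\}|\geq \lceil\frac{p}{3}\rceil$; (2) if $\sum_{i=1}^p x_i=(p-1)!-k$, then $|\{i\mid x_i=x_{\max}\}|\geq p-k-2$; (3) $\sum_{i=1}^p x_i\leq (p-1)!-\lceil\frac{p}{3}\rceil+2$. -}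

module Defs where

open import Data.Nat using (ℕ; zero; suc; _+_; _*_; _∸_; _⊔_; _≟_; _≤?_; _≡ᵇ_)
open import Data.Nat.DivMod using (_/_)
open import Data.Fin using (Fin; toℕ) renaming (zero to fzero; suc to fsuc)
open import Data.Bool using (Bool; true; false; if_then_else_; _∨_)
open import Relation.Nullary using (Dec; yes; no)
open import Relation.Nullary.Decidable using (⌊_⌋)

∑ : (n : ℕ) → (Fin n → ℕ) → ℕ
∑ zero    f = 0
∑ (suc n) f = f fzero + ∑ n (λ i → f (fsuc i))

maxF : (n : ℕ) → (Fin n → ℕ) → ℕ
maxF zero    f = 0
maxF (suc n) f = f fzero ⊔ maxF n (λ i → f (fsuc i))

count : (n : ℕ) → {P : Fin n → Set} → ((i : Fin n) → Dec (P i)) → ℕ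
count n P? = ∑ n (λ i → if ⌊ P? i ⌋ then 1 else 0)

-- The p × p tridiagonal matrix M of the paper, with 0-based indices
-- (paper index r corresponds to Fin element with toℕ = r - 1):
--   diagonal: p-1 at the first and last position, p-2 otherwise;
--   off-diagonal neighbours: 1;  everything else: 0.
M : (p : ℕ) → Fin p → Fin p → ℕ
M p i j with toℕ i ≟ toℕ j
... | yes _ = if (toℕ i ≡ᵇ 0) ∨ (toℕ i ≡ᵇ p ∸ 1) then p ∸ 1 else p ∸ 2
... | no  _ = if (suc (toℕ i) ≡ᵇ toℕ j) ∨ (suc (toℕ j) ≡ᵇ toℕ i) then 1 else 0

Mx : (p : ℕ) → (Fin p → ℕ) → Fin p → ℕ
Mx p x i = ∑ p (λ j → M p i j * x j)

⌈_/3⌉ : ℕ → ℕ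
⌈ n /3⌉ = (n + 2) / 3

-- By Wilson's theorem N = (p - 1)! satisfies N + 1 = p m, so an entry is small (p xᵢ ≤ N)
-- exactly when xᵢ < m.  Row i of M x ≤ N reads x_{i-1} + (p - 2) xᵢ + x_{i+1} < p m, where an
-- end row uses its own entry in place of the missing neighbour.  Hence no three consecutive
-- entries are all ≥ m, and as every index lies in exactly three such windows, (1) follows.
-- With the deficits dᵢ = m ∸ xᵢ and excesses eᵢ = xᵢ ∸ m, each row also gives
-- [xᵢ ≥ m] + (p - 2) eᵢ ≤ d_{i-1} + d_{i+1}; summing, and using ∑ x + ∑ d = p m + ∑ e, yields
-- p + 3 ∑ e ≤ 3 ∑ d, hence ∑ x + ⌈p/3⌉ ≤ N + 1, i.e. (3).  For (2): if no entry exceeds m,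
-- every non-maximal entry has dᵢ ≥ 1, so p - #max ≤ ∑ d = p m - ∑ x; otherwise the two
-- neighbours of an entry above m carry deficit ≥ p - 1, and the same sums force ∑ x ≤ N + 3 - p.

module Submission where

open import Defs
open import Data.Nat
open import Data.Nat.Properties
open import Data.Nat.DivMod using (_/_; _%_; m<n*o⇒m/o<n; +-distrib-/-∣ʳ; m*n/n≡m; m%n<n; m≡m%n+[m/n]*n)
open import Data.Nat.Divisibility using (_∣_; divides; n∣m*n; ∣m+n∣m⇒∣n; >⇒∤; ∣1⇒≡1)
open import Data.Nat.Primality using (Prime; euclidsLemma)
open import Data.Nat.Coprimality using (prime⇒coprime; coprime-Bézout)
open import Data.Nat.GCD using (module Bézout)
open import Algebra.Properties.CommutativeSemigroup +-commutativeSemigroup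
  using () renaming (interchange to +-interchange; xy∙z≈xz∙y to +-right-comm)
open import Algebra.Properties.CommutativeSemigroup *-commutativeSemigroup
  using () renaming (x∙yz≈y∙xz to *-left-comm)
open import Data.Nat.Tactic.RingSolver using (solve-∀)
open import Data.Fin using (Fin; toℕ; fromℕ<) renaming (zero to fzero; suc to fsuc)
open import Data.Bool using (Bool; true; false; if_then_else_; _∨_)
open import Data.Bool.Properties using (T-≡; ¬-not; ∨-zeroʳ)
open import Data.Sum using (inj₁; inj₂)
open import Data.Product using (_×_; _,_; proj₁; proj₂; ∃; ∃₂)
open import Function using (_∘′_; _⇔_; Equivalence; mk⇔)
open import Data.Fin.Properties using (toℕ-fromℕ<; toℕ<n)
open import Relation.Nullary using (Dec; yes; no; ¬_; contradiction)
open import Relation.Nullary.Decidable using (⌊_⌋; _×-dec_; toWitness; fromWitness)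
open import Relation.Binary.PropositionalEquality

∑< : ℕ → (ℕ → ℕ) → ℕ
∑< n f = ∑ n (λ i → f (toℕ i))

∑<-cong : ∀ n {f g : ℕ → ℕ} → (∀ j → j < n → f j ≡ g j) → ∑< n f ≡ ∑< n g
∑<-cong zero    f≗g = refl
∑<-cong (suc n) f≗g = cong₂ _+_ (f≗g 0 z<s) (∑<-cong n (λ j j<n → f≗g (suc j) (s<s j<n)))

∑<-mono-≤ : ∀ n {f g : ℕ → ℕ} → (∀ j → j < n → f j ≤ g j) → ∑< n f ≤ ∑< n g
∑<-mono-≤ zero    f≤g = z≤n
∑<-mono-≤ (suc n) f≤g = +-mono-≤ (f≤g 0 z<s) (∑<-mono-≤ n (λ j j<n → f≤g (suc j) (s<s j<n)))

∑<-distrib-+ : ∀ n (f g : ℕ → ℕ) → ∑< n (λ j → f j + g j) ≡ ∑< n f + ∑< n g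
∑<-distrib-+ zero    f g = refl
∑<-distrib-+ (suc n) f g = trans (cong (f 0 + g 0 +_) (∑<-distrib-+ n (f ∘′ suc) (g ∘′ suc)))
                                 (+-interchange (f 0) (g 0) _ _)

∑<-*-distribˡ : ∀ n c (f : ℕ → ℕ) → ∑< n (λ j → c * f j) ≡ c * ∑< n f
∑<-*-distribˡ zero    c f = sym (*-zeroʳ c)
∑<-*-distribˡ (suc n) c f = trans (cong (c * f 0 +_) (∑<-*-distribˡ n c (f ∘′ suc)))
                                  (sym (*-distribˡ-+ c (f 0) _))

∑<-const : ∀ n c → ∑< n (λ _ → c) ≡ n * c
∑<-const zero    c = refl
∑<-const (suc n) c = cong (c +_) (∑<-const n c)

∑<-last : ∀ n (f : ℕ → ℕ) → ∑< (suc n) f ≡ ∑< n f + f n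
∑<-last zero    f = +-comm (f 0) 0
∑<-last (suc n) f = trans (cong (f 0 +_) (∑<-last n (f ∘′ suc))) (sym (+-assoc (f 0) _ _))

≤-∑<₁ : ∀ {n} (f : ℕ → ℕ) {u} → u < n → f u ≤ ∑< n f
≤-∑<₁ {suc n} f {zero}  _         = m≤m+n (f 0) _
≤-∑<₁ {suc n} f {suc u} (s<s u<n) = ≤-trans (≤-∑<₁ (f ∘′ suc) u<n) (m≤n+m _ (f 0))

≤-∑<₂ : ∀ {n} (f : ℕ → ℕ) {u v} → u < v → v < n → f u + f v ≤ ∑< n f
≤-∑<₂ {suc n} f {zero}  {suc v} _         (s<s v<n) = +-monoʳ-≤ (f 0) (≤-∑<₁ (f ∘′ suc) v<n)
≤-∑<₂ {suc n} f {suc u} {suc v} (s<s u<v) (s<s v<n) =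
  ≤-trans (≤-∑<₂ (f ∘′ suc) u<v v<n) (m≤n+m _ (f 0))

≤-∑<₃ : ∀ {n} (f : ℕ → ℕ) {u v w} → u < v → v < w → w < n → f u + f v + f w ≤ ∑< n f
≤-∑<₃ {suc n} f {zero}  {suc v} {suc w} _         v<w       (s<s w<n) =
  ≤-trans (≤-reflexive (+-assoc (f 0) _ _)) (+-monoʳ-≤ (f 0) (≤-∑<₂ (f ∘′ suc) (s≤s⁻¹ v<w) w<n))
≤-∑<₃ {suc n} f {suc u} {suc v} {suc w} (s<s u<v) (s<s v<w) (s<s w<n) =
  ≤-trans (≤-∑<₃ (f ∘′ suc) u<v v<w w<n) (m≤n+m _ (f 0))

∑<-window : ∀ L (g : ℕ → ℕ) →
  ∑< (suc L) (λ a → g (pred a) + g a + g (suc a ⊓ L)) ≡ 3 * ∑< (suc L) g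
∑<-window L g = begin
  ∑< (suc L) (λ a → g (pred a) + g a + g (suc a ⊓ L))
    ≡⟨ ∑<-distrib-+ (suc L) (λ a → g (pred a) + g a) (λ a → g (suc a ⊓ L)) ⟩
  ∑< (suc L) (λ a → g (pred a) + g a) + ∑< (suc L) (λ a → g (suc a ⊓ L))
    ≡⟨ cong₂ _+_ (∑<-distrib-+ (suc L) (g ∘′ pred) g) ∑<-next ⟩
  (g 0 + ∑< L g) + G + (∑< L (g ∘′ suc) + g L)
    ≡⟨ rearrange (g 0) (∑< L g) G (∑< L (g ∘′ suc)) (g L) ⟩
  (∑< L g + g L) + (g 0 + ∑< L (g ∘′ suc)) + G
    ≡⟨ cong (λ t → t + G + G) (sym (∑<-last L g)) ⟩
  G + G + G
    ≡⟨ triple G ⟩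
  3 * G ∎
  where
  open ≡-Reasoning
  G = ∑< (suc L) g
  ∑<-next : ∑< (suc L) (λ a → g (suc a ⊓ L)) ≡ ∑< L (g ∘′ suc) + g L
  ∑<-next = trans (∑<-last L (λ a → g (suc a ⊓ L)))
    (cong₂ _+_ (∑<-cong L {λ a → g (suc a ⊓ L)} (λ a a<L → cong g (m≤n⇒m⊓n≡m a<L)))
               (cong g (m≥n⇒m⊓n≡n (n≤1+n L))))
  rearrange : ∀ a b c d e → a + b + c + (d + e) ≡ b + e + (a + d) + c
  rearrange = solve-∀
  triple : ∀ a → a + a + a ≡ 3 * a
  triple = solve-∀

𝟙 : ∀ {a} {A : Set a} → Dec A → ℕ
𝟙 d = if ⌊ d ⌋ then 1 else 0

𝟙-yes : ∀ {a} {A : Set a} (d : Dec A) → A → 𝟙 d ≡ 1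
𝟙-yes (yes _) _ = refl
𝟙-yes (no ¬a) a = contradiction a ¬a

𝟙-no : ∀ {a} {A : Set a} (d : Dec A) → ¬ A → 𝟙 d ≡ 0
𝟙-no (yes a) ¬a = contradiction a ¬a
𝟙-no (no _)  _  = refl

𝟙-cong : ∀ {a b} {A : Set a} {B : Set b} → A ⇔ B → (d : Dec A) (e : Dec B) → 𝟙 d ≡ 𝟙 e
𝟙-cong A⇔B (yes a) e = sym (𝟙-yes e (Equivalence.to A⇔B a))
𝟙-cong A⇔B (no ¬a) e = sym (𝟙-no e (¬a ∘′ Equivalence.from A⇔B))

𝟙≤1 : ∀ {a} {A : Set a} (d : Dec A) → 𝟙 d ≤ 1
𝟙≤1 (yes _) = ≤-refl
𝟙≤1 (no _)  = z≤n

⌈/3⌉-least : ∀ {n c} → n ≤ 3 * c → ⌈ n /3⌉ ≤ c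
⌈/3⌉-least {n} {c} n≤3c = s≤s⁻¹ (m<n*o⇒m/o<n (begin-strict
  n + 2         <⟨ +-monoˡ-< 2 (s≤s (≤-trans n≤3c (≤-reflexive (*-comm 3 c)))) ⟩
  suc (c * 3) + 2 ≡⟨ +-comm (suc (c * 3)) 2 ⟩
  suc c * 3     ∎))
  where open ≤-Reasoning

⌈/3⌉-+-* : ∀ n t → ⌈ n + 3 * t /3⌉ ≡ ⌈ n /3⌉ + t
⌈/3⌉-+-* n t = begin
  (n + 3 * t + 2) / 3    ≡⟨ cong (_/ 3) (shuffle n t) ⟩
  (n + 2 + t * 3) / 3    ≡⟨ +-distrib-/-∣ʳ (n + 2) (n∣m*n t) ⟩
  (n + 2) / 3 + t * 3 / 3 ≡⟨ cong ((n + 2) / 3 +_) (m*n/n≡m t 3) ⟩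
  (n + 2) / 3 + t        ∎
  where
  open ≡-Reasoning
  shuffle : ∀ n t → n + 3 * t + 2 ≡ n + 2 + t * 3
  shuffle = solve-∀

m+[n∸m]≡n+[m∸n] : ∀ m n → m + (n ∸ m) ≡ n + (m ∸ n)
m+[n∸m]≡n+[m∸n] m n with ≤-total m n
... | inj₁ m≤n = begin
  m + (n ∸ m) ≡⟨ m+[n∸m]≡n m≤n ⟩
  n           ≡⟨ +-identityʳ n ⟨
  n + 0       ≡⟨ cong (n +_) (m≤n⇒m∸n≡0 m≤n) ⟨
  n + (m ∸ n) ∎
  where open ≡-Reasoning
... | inj₂ n≤m = begin
  m + (n ∸ m) ≡⟨ cong (m +_) (m≤n⇒m∸n≡0 n≤m) ⟩
  m + 0       ≡⟨ +-identityʳ m ⟩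
  m           ≡⟨ m+[n∸m]≡n n≤m ⟨
  n + (m ∸ n) ∎
  where open ≡-Reasoning

∑<-complement : ∀ n (f : ℕ → ℕ) → (∀ j → f j ≤ 1) → ∑< n (λ j → 1 ∸ f j) + ∑< n f ≡ n
∑<-complement n f f≤1 = begin
  ∑< n (λ j → 1 ∸ f j) + ∑< n f ≡⟨ ∑<-distrib-+ n (λ j → 1 ∸ f j) f ⟨
  ∑< n (λ j → 1 ∸ f j + f j)     ≡⟨ ∑<-cong n (λ j _ → m∸n+n≡m (f≤1 j)) ⟩
  ∑< n (λ _ → 1)                 ≡⟨ ∑<-const n 1 ⟩
  n * 1                          ≡⟨ *-identityʳ n ⟩
  n                              ∎
  where open ≡-Reasoning

≡ᵇ-refl : ∀ n → (n ≡ᵇ n) ≡ true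
≡ᵇ-refl n = Equivalence.to T-≡ (≡⇒≡ᵇ n n refl)

≢⇒≡ᵇ≡false : ∀ {m n} → m ≢ n → (m ≡ᵇ n) ≡ false
≢⇒≡ᵇ≡false {m} {n} m≢n = ¬-not (m≢n ∘′ ≡ᵇ⇒≡ m n ∘′ Equivalence.from T-≡)

≢0∧≢1⇒2≤ : ∀ {n} → n ≢ 0 → n ≢ 1 → 2 ≤ n
≢0∧≢1⇒2≤ {0}           n≢0 _   = contradiction refl n≢0
≢0∧≢1⇒2≤ {1}           _   n≢1 = contradiction refl n≢1
≢0∧≢1⇒2≤ {suc (suc _)} _   _   = s≤s (s≤s z≤n)

∏< : ℕ → (ℕ → ℕ) → ℕ
∏< zero    f = 1
∏< (suc n) f = f 0 * ∏< n (f ∘′ suc)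

∏<-cong : ∀ n {f g : ℕ → ℕ} → (∀ j → j < n → f j ≡ g j) → ∏< n f ≡ ∏< n g
∏<-cong zero    f≗g = refl
∏<-cong (suc n) f≗g = cong₂ _*_ (f≗g 0 z<s) (∏<-cong n (λ j j<n → f≗g (suc j) (s<s j<n)))

∏<-last : ∀ n (f : ℕ → ℕ) → ∏< (suc n) f ≡ ∏< n f * f n
∏<-last zero    f = trans (*-identityʳ (f 0)) (sym (+-identityʳ (f 0)))
∏<-last (suc n) f = trans (cong (f 0 *_) (∏<-last n (f ∘′ suc))) (sym (*-assoc (f 0) _ _))

∏<-ones : ∀ n → ∏< n (λ _ → 1) ≡ 1
∏<-ones zero    = refl
∏<-ones (suc n) = trans (+-identityʳ _) (∏<-ones n)

!≡∏<-⊔1 : ∀ n → n ! ≡ ∏< (suc n) (_⊔ 1)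
!≡∏<-⊔1 zero    = refl
!≡∏<-⊔1 (suc n) = begin
  suc n * n !                     ≡⟨ *-comm (suc n) (n !) ⟩
  n ! * suc n                     ≡⟨ cong (_* suc n) (!≡∏<-⊔1 n) ⟩
  ∏< (suc n) (_⊔ 1) * suc n       ≡⟨ cong (λ t → ∏< (suc n) (_⊔ 1) * suc t) (⊔-identityʳ n) ⟨
  ∏< (suc n) (_⊔ 1) * (suc n ⊔ 1) ≡⟨ ∏<-last (suc n) (_⊔ 1) ⟨
  ∏< (2 + n) (_⊔ 1)               ∎
  where open ≡-Reasoning

_─_ : (ℕ → Bool) → ℕ → ℕ → Bool
(S ─ a) j = if j ≡ᵇ a then false else S j

─-elim : ∀ S {a j} → (S ─ a) j ≡ true → j ≢ a × S j ≡ true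
─-elim S {a} {j} S─a∋j with j ≡ᵇ a in j≡ᵇa
... | false = (λ { refl → contradiction (trans (sym (≡ᵇ-refl j)) j≡ᵇa) λ () }) , S─a∋j

─-intro : ∀ S {a j} → j ≢ a → S j ≡ true → (S ─ a) j ≡ true
─-intro S {a} {j} j≢a Sj rewrite ≢⇒≡ᵇ≡false j≢a = Sj

∏<-remove : ∀ n (f : ℕ → ℕ) (S : ℕ → Bool) {a} → a < n → S a ≡ true →
  ∏< n (λ j → if S j then f j else 1) ≡ f a * ∏< n (λ j → if (S ─ a) j then f j else 1)
∏<-remove (suc n) f S {zero} _ S0 rewrite S0 = cong (f 0 *_) (sym (+-identityʳ _))
∏<-remove (suc n) f S {suc a} (s<s a<n) Sa =
  trans (cong ((if S 0 then f 0 else 1) *_) (∏<-remove n (f ∘′ suc) (S ∘′ suc) a<n Sa))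
        (*-left-comm (if S 0 then f 0 else 1) (f (suc a)) _)

module Wilson {R : ℕ} (prime : Prime (2 + R)) where

  private
    p : ℕ
    p = 2 + R

  infix 4 _≈_
  _≈_ : ℕ → ℕ → Set
  a ≈ b = ∃₂ λ x y → a + x * p ≡ b + y * p

  ≈-refl : ∀ {a} → a ≈ a
  ≈-refl = 0 , 0 , refl

  ≈-sym : ∀ {a b} → a ≈ b → b ≈ a
  ≈-sym (x , y , eq) = y , x , sym eq

  ≈-suc : ∀ {a b} → a ≈ b → suc a ≈ suc b
  ≈-suc (x , y , eq) = x , y , cong suc eq

  ≈-trans : ∀ {a b c} → a ≈ b → b ≈ c → a ≈ c
  ≈-trans {a} {b} {c} (x , y , a≈b) (z , w , b≈c) = x + z , y + w , (begin
    a + (x + z) * p     ≡⟨ split a x z p ⟩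
    a + x * p + z * p   ≡⟨ cong (_+ z * p) a≈b ⟩
    b + y * p + z * p   ≡⟨ +-right-comm b (y * p) (z * p) ⟩
    b + z * p + y * p   ≡⟨ cong (_+ y * p) b≈c ⟩
    c + w * p + y * p   ≡⟨ +-right-comm c (w * p) (y * p) ⟩
    c + y * p + w * p   ≡⟨ split c y w p ⟨
    c + (y + w) * p     ∎)
    where
    open ≡-Reasoning
    split : ∀ a x z p → a + (x + z) * p ≡ a + x * p + z * p
    split = solve-∀

  ≈-*-cong : ∀ {a b c d} → a ≈ b → c ≈ d → a * c ≈ b * d
  ≈-*-cong {a} {b} {c} {d} (x , y , a≈b) (z , w , c≈d) =
    a * z + x * c + x * z * p , b * w + y * d + y * w * p , (begin
      a * c + (a * z + x * c + x * z * p) * p ≡⟨ expand a c x z p ⟩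
      (a + x * p) * (c + z * p)               ≡⟨ cong₂ _*_ a≈b c≈d ⟩
      (b + y * p) * (d + w * p)               ≡⟨ expand b d y w p ⟨
      b * d + (b * w + y * d + y * w * p) * p ∎)
    where
    open ≡-Reasoning
    expand : ∀ a c x z p → a * c + (a * z + x * c + x * z * p) * p ≡ (a + x * p) * (c + z * p)
    expand = solve-∀

  ≤∧≈⇒∣∸ : ∀ {a b} → a ≤ b → a ≈ b → p ∣ b ∸ a
  ≤∧≈⇒∣∸ {a} {b} a≤b (x , y , a≈b) =
    ∣m+n∣m⇒∣n (subst (p ∣_) x*p≡y*p+[b∸a] (n∣m*n x)) (n∣m*n y)
    where
    open ≡-Reasoning
    x*p≡y*p+[b∸a] : x * p ≡ y * p + (b ∸ a)
    x*p≡y*p+[b∸a] = +-cancelʳ-≡ a _ _ (begin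
      x * p + a           ≡⟨ +-comm (x * p) a ⟩
      a + x * p           ≡⟨ a≈b ⟩
      b + y * p           ≡⟨ cong (_+ y * p) (m∸n+n≡m a≤b) ⟨
      b ∸ a + a + y * p   ≡⟨ regroup (b ∸ a) a (y * p) ⟩
      y * p + (b ∸ a) + a ∎)
      where
      regroup : ∀ d a t → d + a + t ≡ t + d + a
      regroup = solve-∀

  ∣∧<⇒≡0 : ∀ {c} → p ∣ c → c < p → c ≡ 0
  ∣∧<⇒≡0 {zero}  _   _   = refl
  ∣∧<⇒≡0 {suc c} p∣c c<p = contradiction p∣c (>⇒∤ c<p)

  0≉1 : ¬ (0 ≈ 1)
  0≉1 0≈1 with () ← ∣1⇒≡1 (≤∧≈⇒∣∸ z≤n 0≈1)

  *-cancelʳ-≈-≤ : ∀ {x z y} → x ≤ z → z < p → 0 < y → y < p → x * y ≈ z * y → z ≤ x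
  *-cancelʳ-≈-≤ {x} {z} {y} x≤z z<p 0<y y<p xy≈zy
    with euclidsLemma (z ∸ x) y prime
           (subst (p ∣_) (sym (*-distribʳ-∸ y z x)) (≤∧≈⇒∣∸ (*-monoˡ-≤ y x≤z) xy≈zy))
  ... | inj₁ p∣z∸x = m∸n≡0⇒m≤n (∣∧<⇒≡0 p∣z∸x (≤-<-trans (m∸n≤m z x) z<p))
  ... | inj₂ p∣y   = contradiction (∣∧<⇒≡0 p∣y y<p) (≢-sym (<⇒≢ 0<y))

  *-cancelʳ-≈ : ∀ {x z y} → x < p → z < p → 0 < y → y < p → x * y ≈ z * y → x ≡ z
  *-cancelʳ-≈ {x} {z} x<p z<p 0<y y<p xy≈zy with ≤-total x z
  ... | inj₁ x≤z = ≤-antisym x≤z (*-cancelʳ-≈-≤ x≤z z<p 0<y y<p xy≈zy)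
  ... | inj₂ z≤x = ≤-antisym (*-cancelʳ-≈-≤ z≤x x<p 0<y y<p (≈-sym xy≈zy)) z≤x

  inverse-unique : ∀ {x z y} → x < p → z < p → 0 < y → y < p → x * y ≈ 1 → z * y ≈ 1 → x ≡ z
  inverse-unique x<p z<p 0<y y<p xy≈1 zy≈1 = *-cancelʳ-≈ x<p z<p 0<y y<p (≈-trans xy≈1 (≈-sym zy≈1))

  inverse-exists : ∀ {a} → 0 < a → a < p → ∃ λ b → b < p × a * b ≈ 1
  inverse-exists {a@(suc _)} _ a<p =
    b₀ % p , m%n<n b₀ p , ≈-trans (≈-*-cong (≈-refl {a}) (≈-sym b₀≈b₀%p)) ab₀≈1
    where
    inverse-mod : ∃ λ b₀ → a * b₀ ≈ 1
    inverse-mod with coprime-Bézout (prime⇒coprime prime a<p)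
    -- Here y a ≡ -1 (mod p), so y (p - 1) is an inverse of a.
    ... | Bézout.+- x y 1+ya≡xp = y * suc R , 1 , x * suc R , (begin
      a * (y * suc R) + 1 * p ≡⟨ expand a y R ⟩
      (1 + y * a) * suc R + 1 ≡⟨ cong (λ t → t * suc R + 1) 1+ya≡xp ⟩
      x * p * suc R + 1       ≡⟨ rearrange x R ⟩
      1 + x * suc R * p       ∎)
      where
      open ≡-Reasoning
      expand : ∀ a y R → a * (y * suc R) + 1 * (2 + R) ≡ (1 + y * a) * suc R + 1
      expand = solve-∀
      rearrange : ∀ x R → x * (2 + R) * suc R + 1 ≡ 1 + x * suc R * (2 + R)
      rearrange = solve-∀
    ... | Bézout.-+ x y 1+xp≡ya = y , 0 , x , trans (+-identityʳ (a * y)) (trans (*-comm a y) (sym 1+xp≡ya))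
    b₀ : ℕ
    b₀ = proj₁ inverse-mod
    ab₀≈1 : a * b₀ ≈ 1
    ab₀≈1 = proj₂ inverse-mod
    b₀≈b₀%p : b₀ ≈ b₀ % p
    b₀≈b₀%p = 0 , b₀ / p , trans (+-identityʳ b₀) (m≡m%n+[m/n]*n b₀ p)

  no-self-inverse : ∀ {a} → 2 ≤ a → a ≤ R → ¬ (a * a ≈ 1)
  no-self-inverse {suc c} (s≤s 1≤c) 1+c≤R a²≈1
    with euclidsLemma c (2 + c) prime
           (subst (p ∣_) (a²∸1≡c[2+c] c) (≤∧≈⇒∣∸ (s≤s z≤n) (≈-sym a²≈1)))
    where
    a²∸1≡c[2+c] : ∀ c → suc c * suc c ∸ 1 ≡ c * (2 + c)
    a²∸1≡c[2+c] = square-pred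
      where
      square-pred : ∀ c → c + c * suc c ≡ c * (2 + c)
      square-pred = solve-∀
  ... | inj₁ p∣c   = contradiction (∣∧<⇒≡0 p∣c (s≤s (m≤n⇒m≤1+n (<⇒≤ 1+c≤R))))
                                   (≢-sym (<⇒≢ 1≤c))
  ... | inj₂ p∣2+c = contradiction (∣∧<⇒≡0 p∣2+c (s≤s (s≤s 1+c≤R))) λ ()

  Closed : (ℕ → Bool) → Set
  Closed S = ∀ {a} → S a ≡ true → 2 ≤ a × a ≤ R × ∃ λ b → S b ≡ true × a * b ≈ 1

  ∏[_] : (ℕ → Bool) → ℕ
  ∏[ S ] = ∏< p (λ j → if S j then j else 1)

  weight-outside : ∀ {S : ℕ → Bool} {j} → S j ≢ true → (if S j then j else 1) ≡ 1
  weight-outside {S} {j} j∉S with S j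
  ... | true  = contradiction refl j∉S
  ... | false = refl

  -- The largest element n of S pairs off with its inverse b ≠ n; removing both leaves a closed set below n.
  ∏-closed≈1 : ∀ n S → (∀ {a} → S a ≡ true → a < n) → Closed S → ∏[ S ] ≈ 1
  ∏-closed≈1 zero S S⊆∅ _ = subst (_≈ 1) (sym ∏[S]≡1) ≈-refl
    where
    ∏[S]≡1 : ∏[ S ] ≡ 1
    ∏[S]≡1 = trans (∏<-cong p (λ j _ → weight-outside {S} {j} (λ Sj → contradiction (S⊆∅ Sj) λ ())))
                   (∏<-ones p)
  ∏-closed≈1 (suc n) S S⊆1+n closed with S n in Sn
  ... | false = ∏-closed≈1 n S S⊆n closed
    where
    S⊆n : ∀ {a} → S a ≡ true → a < n
    S⊆n Sa = ≤∧≢⇒< (s≤s⁻¹ (S⊆1+n Sa)) λ { refl → contradiction (trans (sym Sa) Sn) λ () }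
  ... | true with 2≤n , n≤R , b , Sb , nb≈1 ← closed Sn =
    subst (_≈ 1) (sym ∏[S]≡n*b*∏[S′]) (≈-*-cong nb≈1 (∏-closed≈1 n S′ S′⊆n closed′))
    where
    n<p : n < p
    n<p = s≤s (m≤n⇒m≤1+n n≤R)
    0<n : 0 < n
    0<n = <-trans z<s 2≤n
    b≢n : b ≢ n
    b≢n refl = no-self-inverse 2≤n n≤R nb≈1
    b<n : b < n
    b<n = ≤∧≢⇒< (s≤s⁻¹ (S⊆1+n Sb)) b≢n
    b<p : b < p
    b<p = <-trans b<n n<p
    0<b : 0 < b
    0<b with 2≤b , _ ← closed Sb = <-trans z<s 2≤b
    bn≈1 : b * n ≈ 1
    bn≈1 = subst (_≈ 1) (*-comm n b) nb≈1
    S′ : ℕ → Bool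
    S′ = (S ─ n) ─ b
    S′-elim : ∀ {c} → S′ c ≡ true → c ≢ b × c ≢ n × S c ≡ true
    S′-elim S′c with c≢b , S─n∋c ← ─-elim (S ─ n) S′c
                with c≢n , Sc ← ─-elim S S─n∋c = c≢b , c≢n , Sc
    S′⊆n : ∀ {c} → S′ c ≡ true → c < n
    S′⊆n S′c with _ , c≢n , Sc ← S′-elim S′c = ≤∧≢⇒< (s≤s⁻¹ (S⊆1+n Sc)) c≢n
    closed′ : Closed S′
    closed′ {c} S′c with c≢b , c≢n , Sc ← S′-elim S′c
                    with 2≤c , c≤R , d , Sd , cd≈1 ← closed Sc =
      2≤c , c≤R , d , ─-intro (S ─ n) d≢b (─-intro S d≢n Sd) , cd≈1
      where
      c<p : c < p
      c<p = s≤s (m≤n⇒m≤1+n c≤R)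
      d≢n : d ≢ n
      d≢n refl = c≢b (inverse-unique c<p b<p 0<n n<p cd≈1 bn≈1)
      d≢b : d ≢ b
      d≢b refl = c≢n (inverse-unique c<p n<p 0<b b<p cd≈1 nb≈1)
    ∏[S]≡n*b*∏[S′] : ∏[ S ] ≡ n * b * ∏[ S′ ]
    ∏[S]≡n*b*∏[S′] = begin
      ∏[ S ]
        ≡⟨ ∏<-remove p (λ j → j) S n<p Sn ⟩
      n * ∏< p (λ j → if (S ─ n) j then j else 1)
        ≡⟨ cong (n *_) (∏<-remove p (λ j → j) (S ─ n) b<p (─-intro S b≢n Sb)) ⟩
      n * (b * ∏[ S′ ])
        ≡⟨ *-assoc n b ∏[ S′ ] ⟨
      n * b * ∏[ S′ ] ∎
      where open ≡-Reasoning

  S₀ : ℕ → Bool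
  S₀ j = ⌊ (2 ≤? j) ×-dec (j ≤? R) ⌋

  S₀-elim : ∀ {j} → S₀ j ≡ true → 2 ≤ j × j ≤ R
  S₀-elim S₀j = toWitness (Equivalence.from T-≡ S₀j)

  S₀-intro : ∀ {j} → 2 ≤ j → j ≤ R → S₀ j ≡ true
  S₀-intro 2≤j j≤R = Equivalence.to T-≡ (fromWitness (2≤j , j≤R))

  S₀-closed : Closed S₀
  S₀-closed {a} S₀a with 2≤a , a≤R ← S₀-elim S₀a
                    with b , b<p , ab≈1 ← inverse-exists (<-trans z<s 2≤a) (s≤s (m≤n⇒m≤1+n a≤R)) =
    2≤a , a≤R , b , S₀-intro 2≤b b≤R , ab≈1
    where
    a<p : a < p
    a<p = s≤s (m≤n⇒m≤1+n a≤R)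
    [1+R]²≈1 : suc R * suc R ≈ 1
    [1+R]²≈1 = 0 , R , square R
      where
      square : ∀ R → suc R * suc R + 0 ≡ 1 + R * (2 + R)
      square = solve-∀
    b≢0 : b ≢ 0
    b≢0 refl = 0≉1 (subst (_≈ 1) (*-zeroʳ a) ab≈1)
    b≢1 : b ≢ 1
    b≢1 refl = <⇒≢ 2≤a (sym (inverse-unique a<p 1<p z<s 1<p ab≈1 ≈-refl))
      where
      1<p : 1 < p
      1<p = s≤s (s≤s z≤n)
    b≢1+R : b ≢ suc R
    b≢1+R refl = <⇒≢ (s≤s a≤R) (inverse-unique a<p (n<1+n (suc R)) z<s (n<1+n (suc R)) ab≈1 [1+R]²≈1)
    2≤b : 2 ≤ b
    2≤b = ≢0∧≢1⇒2≤ b≢0 b≢1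
    b≤R : b ≤ R
    b≤R = s≤s⁻¹ (≤∧≢⇒< (s≤s⁻¹ b<p) b≢1+R)

  ∏[S₀]≡R! : ∏[ S₀ ] ≡ R !
  ∏[S₀]≡R! = begin
    ∏[ S₀ ]                            ≡⟨ ∏<-last (suc R) weight ⟩
    ∏< (suc R) weight * weight (suc R) ≡⟨ cong (∏< (suc R) weight *_) weight[1+R]≡1 ⟩
    ∏< (suc R) weight * 1    ≡⟨ *-identityʳ _ ⟩
    ∏< (suc R) weight        ≡⟨ ∏<-cong (suc R) weight≡⊔1 ⟩
    ∏< (suc R) (_⊔ 1)        ≡⟨ !≡∏<-⊔1 R ⟨
    R !                      ∎
    where
    open ≡-Reasoning
    weight : ℕ → ℕ
    weight j = if S₀ j then j else 1
    weight[1+R]≡1 : weight (suc R) ≡ 1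
    weight[1+R]≡1 = weight-outside {S₀} (λ S₀[1+R] → <-irrefl refl (proj₂ (S₀-elim S₀[1+R])))
    weight≡⊔1 : ∀ j → j < suc R → weight j ≡ j ⊔ 1
    weight≡⊔1 0             _ = refl
    weight≡⊔1 1             _ = refl
    weight≡⊔1 (suc (suc i)) j<1+R
      rewrite S₀-intro {suc (suc i)} (s≤s (s≤s z≤n)) (s≤s⁻¹ j<1+R) = refl

  p∣1+[p∸1]! : p ∣ suc ((p ∸ 1) !)
  p∣1+[p∸1]! = ≤∧≈⇒∣∸ z≤n (≈-sym (≈-trans 1+[1+R]!≈p p≈0))
    where
    R!≈1 : R ! ≈ 1
    R!≈1 = subst (_≈ 1) ∏[S₀]≡R!
                 (∏-closed≈1 (suc R) S₀ (λ S₀a → s≤s (proj₂ (S₀-elim S₀a))) S₀-closed)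
    1+[1+R]!≈p : suc ((suc R) !) ≈ p
    1+[1+R]!≈p = ≈-suc (subst (suc R * R ! ≈_) (*-identityʳ (suc R)) (≈-*-cong (≈-refl {suc R}) R!≈1))
    p≈0 : p ≈ 0
    p≈0 = 0 , 1 , refl

wilson : ∀ {p} → Prime p → p ∣ suc ((p ∸ 1) !)
wilson {suc (suc R)} p-prime = Wilson.p∣1+[p∸1]! p-prime

tridiag : ℕ → ℕ → ℕ → ℕ
tridiag p a b with a ≟ b
... | yes _ = if (a ≡ᵇ 0) ∨ (a ≡ᵇ p ∸ 1) then p ∸ 1 else p ∸ 2
... | no  _ = if (suc a ≡ᵇ b) ∨ (suc b ≡ᵇ a) then 1 else 0

M≡tridiag : ∀ p (i j : Fin p) → M p i j ≡ tridiag p (toℕ i) (toℕ j)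
M≡tridiag p i j with toℕ i ≟ toℕ j
... | yes _ = refl
... | no  _ = refl

tridiag-diag : ∀ p a → tridiag p a a ≡ (if (a ≡ᵇ 0) ∨ (a ≡ᵇ p ∸ 1) then p ∸ 1 else p ∸ 2)
tridiag-diag p a with a ≟ a
... | yes _   = refl
... | no  a≢a = contradiction refl a≢a

tridiag-succ : ∀ p a → tridiag p a (suc a) ≡ 1
tridiag-succ p a with a ≟ suc a
... | yes a≡1+a = contradiction a≡1+a (<⇒≢ (n<1+n a))
... | no  _     rewrite ≡ᵇ-refl a = refl

tridiag-pred : ∀ p a → tridiag p (suc a) a ≡ 1
tridiag-pred p a with suc a ≟ a
... | yes 1+a≡a = contradiction (sym 1+a≡a) (<⇒≢ (n<1+n a))
... | no  _     rewrite ≡ᵇ-refl a = cong (if_then 1 else 0) (∨-zeroʳ (suc (suc a) ≡ᵇ a))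

≡1⇒*-identityˡ : ∀ {c d} → c ≡ 1 → c * d ≡ d
≡1⇒*-identityˡ {d = d} refl = *-identityˡ d

-- In the first and last row the diagonal entry p - 1 = q + 1 pays for the missing
-- neighbour, which is why that neighbour is replaced by the entry itself.
padded-row≤tridiag-row : ∀ q (Y : ℕ → ℕ) {a} → a ≤ suc q →
  Y (pred a) + q * Y a + Y (suc a ⊓ suc q) ≤ ∑< (2 + q) (λ c → tridiag (2 + q) a c * Y c)
padded-row≤tridiag-row q Y {zero} _ =
  ≤-trans (≤-reflexive (cong (Y 0 + q * Y 0 +_) (sym (+-identityʳ (Y 1)))))
          (≤-∑<₂ {2 + q} (λ c → tridiag (2 + q) 0 c * Y c) z<s (s≤s z<s))
padded-row≤tridiag-row q Y {suc b} 1+b≤1+q with m≤n⇒m<n∨m≡n (s≤s⁻¹ 1+b≤1+q)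
... | inj₁ b<q = begin
  Y b + q * Y (suc b) + Y (suc (suc b) ⊓ suc q)
    ≡⟨ cong (λ t → Y b + q * Y (suc b) + Y (suc t)) (m≤n⇒m⊓n≡m b<q) ⟩
  Y b + q * Y (suc b) + Y (2 + b)
    ≡⟨ cong₂ _+_ (cong₂ _+_ (≡1⇒*-identityˡ (tridiag-pred (2 + q) b)) (cong (_* Y (suc b)) diag≡q))
                 (≡1⇒*-identityˡ (tridiag-succ (2 + q) (suc b))) ⟨
  T b + T (suc b) + T (2 + b)
    ≤⟨ ≤-∑<₃ T (n<1+n b) (n<1+n (suc b)) (s≤s (s≤s b<q)) ⟩
  ∑< (2 + q) T ∎
  where
  open ≤-Reasoning
  T : ℕ → ℕ
  T c = tridiag (2 + q) (suc b) c * Y c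
  diag≡q : tridiag (2 + q) (suc b) (suc b) ≡ q
  diag≡q rewrite tridiag-diag (2 + q) (suc b) | ≢⇒≡ᵇ≡false (<⇒≢ b<q) = refl
... | inj₂ refl = begin
  Y b + b * Y (suc b) + Y (suc (suc b) ⊓ suc b)
    ≡⟨ cong (λ t → Y b + b * Y (suc b) + Y t) (m≥n⇒m⊓n≡n (n≤1+n (suc b))) ⟩
  Y b + b * Y (suc b) + Y (suc b)
    ≡⟨ trans (+-assoc (Y b) _ _) (cong (Y b +_) (+-comm (b * Y (suc b)) (Y (suc b)))) ⟩
  Y b + suc b * Y (suc b)
    ≡⟨ cong₂ _+_ (≡1⇒*-identityˡ (tridiag-pred (2 + b) b)) (cong (_* Y (suc b)) diag≡1+b) ⟨
  T b + T (suc b)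
    ≤⟨ ≤-∑<₂ T (n<1+n b) (n<1+n (suc b)) ⟩
  ∑< (2 + b) T ∎
  where
  open ≤-Reasoning
  T : ℕ → ℕ
  T c = tridiag (2 + b) (suc b) c * Y c
  diag≡1+b : tridiag (2 + b) (suc b) (suc b) ≡ suc b
  diag≡1+b rewrite tridiag-diag (2 + b) (suc b) | ≡ᵇ-refl b = refl

-- q (D + 1) = (q - 2)(D + 1) + 2 D + 2 ≥ (q - 2)(q + s) + l + q E + 2, and the constraints on
-- l, s and q make the right-hand side at least q (q + E) + q.
deficit-absorbs-excess : ∀ {q s l D E} → 5 ≤ q → 3 ≤ s → l + s ≡ 2 + q →
                         q + s ≤ D + 1 → l + q * E ≤ 2 * D → q + E ≤ D
deficit-absorbs-excess {q} {s} {l} {D} {E} 5≤q 3≤s l+s≡p q+s≤D+1 l+qE≤2D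
  with q ∸ 5 | m+[n∸m]≡n 5≤q | s ∸ 3 | m+[n∸m]≡n 3≤s
... | k | refl | c | refl =
  *-cancelˡ-≤ q (+-cancelʳ-≤ q _ _ (≤-trans (m≤m+n _ k) (begin
    q * (q + E) + q + k                        ≡⟨ expand k E ⟩
    (3 + k) * (8 + k) + (4 + k) + 2 + q * E    ≡⟨ cong (λ t → (3 + k) * (8 + k) + t + 2 + q * E) l+c≡4+k ⟨
    (3 + k) * (8 + k) + (l + c) + 2 + q * E
      ≤⟨ +-monoˡ-≤ (q * E) (+-monoˡ-≤ 2 (+-monoʳ-≤ ((3 + k) * (8 + k)) (+-monoʳ-≤ l (m≤n*m c (3 + k))))) ⟩
    (3 + k) * (8 + k) + (l + (3 + k) * c) + 2 + q * E ≡⟨ regroup k l c E ⟩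
    (3 + k) * (q + s) + (l + q * E) + 2
      ≤⟨ +-monoˡ-≤ 2 (+-mono-≤ (*-monoʳ-≤ (3 + k) q+s≤D+1) l+qE≤2D) ⟩
    (3 + k) * (D + 1) + 2 * D + 2              ≡⟨ collect k D ⟩
    q * D + q                                  ∎)))
  where
  open ≤-Reasoning
  shift3 : ∀ l c → 3 + (l + c) ≡ l + (3 + c)
  shift3 = solve-∀
  l+c≡4+k : l + c ≡ 4 + k
  l+c≡4+k = +-cancelˡ-≡ 3 _ _ (trans (shift3 l c) l+s≡p)
  expand : ∀ k E → (5 + k) * (5 + k + E) + (5 + k) + k ≡ (3 + k) * (8 + k) + (4 + k) + 2 + (5 + k) * E
  expand = solve-∀
  regroup : ∀ k l c E → (3 + k) * (8 + k) + (l + (3 + k) * c) + 2 + (5 + k) * E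
                      ≡ (3 + k) * (5 + k + (3 + c)) + (l + (5 + k) * E) + 2
  regroup = solve-∀
  collect : ∀ k D → (3 + k) * (D + 1) + 2 * D + 2 ≡ (5 + k) * D + (5 + k)
  collect = solve-∀

-- The rows of M Y ≤ N for N + 1 = (2 + q) m, in the padded form of padded-row≤tridiag-row.
module TridiagonalBounds (q m : ℕ) (Y : ℕ → ℕ)
  (row : ∀ {a} → a ≤ suc q → Y (pred a) + q * Y a + Y (suc a ⊓ suc q) < (2 + q) * m) where

  private
    p L : ℕ
    p = 2 + q
    L = suc q

  small deficit excess : ℕ → ℕ
  small   a = 𝟙 (Y a <? m)
  deficit a = m ∸ Y a
  excess  a = Y a ∸ m

  small≡0 : ∀ {a} → m ≤ Y a → small a ≡ 0
  small≡0 {a} m≤Ya = 𝟙-no (Y a <? m) (≤⇒≯ m≤Ya)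

  small≤deficit : ∀ a → small a ≤ deficit a
  small≤deficit a with Y a <? m
  ... | yes Ya<m = m<n⇒0<n∸m Ya<m
  ... | no  _    = z≤n

  no-large-window : ∀ {a} → a ≤ L → ¬ (m ≤ Y (pred a) × m ≤ Y a × m ≤ Y (suc a ⊓ L))
  no-large-window {a} a≤L (m≤u , m≤v , m≤w) = <⇒≱ (row a≤L) (begin
    (2 + q) * m                          ≡⟨ spread q m ⟩
    m + q * m + m                        ≤⟨ +-mono-≤ (+-mono-≤ m≤u (*-monoʳ-≤ q m≤v)) m≤w ⟩
    Y (pred a) + q * Y a + Y (suc a ⊓ L) ∎)
    where
    open ≤-Reasoning
    spread : ∀ q m → (2 + q) * m ≡ m + q * m + m
    spread = solve-∀

  window-has-small : ∀ {a} → a ≤ L → 1 ≤ small (pred a) + small a + small (suc a ⊓ L)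
  window-has-small {a} a≤L with Y (pred a) <? m | Y a <? m | Y (suc a ⊓ L) <? m
  ... | yes _  | _      | _      = s≤s z≤n
  ... | no _   | yes _  | _      = s≤s z≤n
  ... | no _   | no _   | yes _  = s≤s z≤n
  ... | no u≮m | no v≮m | no w≮m =
    contradiction (≮⇒≥ u≮m , ≮⇒≥ v≮m , ≮⇒≥ w≮m) (no-large-window a≤L)

  excess-bounded-by-neighbours : ∀ {a} → a ≤ L →
    (1 ∸ small a) + q * excess a ≤ deficit (pred a) + deficit (suc a ⊓ L)
  excess-bounded-by-neighbours {a} a≤L with Y a <? m
  ... | yes Ya<m = ≤-trans (≤-reflexive (trans (cong (q *_) excess≡0) (*-zeroʳ q))) z≤n
    where
    excess≡0 : excess a ≡ 0
    excess≡0 = m≤n⇒m∸n≡0 (<⇒≤ Ya<m)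
  ... | no Ya≮m = +-cancelˡ-≤ (u + w) _ _ (begin
    u + w + (1 + q * t)            ≤⟨ +-cancelʳ-≤ (q * m) _ _ row′ ⟩
    m + m                          ≤⟨ +-mono-≤ (m≤n+m∸n m u) (m≤n+m∸n m w) ⟩
    u + (m ∸ u) + (w + (m ∸ w))    ≡⟨ +-interchange u (m ∸ u) w (m ∸ w) ⟩
    u + w + (m ∸ u + (m ∸ w))      ∎)
    where
    open ≤-Reasoning
    u w t : ℕ
    u = Y (pred a)
    w = Y (suc a ⊓ L)
    t = excess a
    m≤Ya : m ≤ Y a
    m≤Ya = ≮⇒≥ Ya≮m
    regroup : ∀ u w t m q → u + w + (1 + q * t) + q * m ≡ suc (u + q * (t + m) + w)
    regroup = solve-∀
    spread : ∀ q m → (2 + q) * m ≡ m + m + q * m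
    spread = solve-∀
    row′ : u + w + (1 + q * t) + q * m ≤ m + m + q * m
    row′ = begin
      u + w + (1 + q * t) + q * m ≡⟨ regroup u w t m q ⟩
      suc (u + q * (t + m) + w)   ≡⟨ cong (λ y → suc (u + q * y + w)) (m∸n+n≡m m≤Ya) ⟩
      suc (u + q * Y a + w)       ≤⟨ row a≤L ⟩
      (2 + q) * m                 ≡⟨ spread q m ⟩
      m + m + q * m               ∎

  #small #large #deficit #excess total : ℕ
  #small   = ∑< p small
  #large   = ∑< p (λ a → 1 ∸ small a)
  #deficit = ∑< p deficit
  #excess  = ∑< p excess
  total    = ∑< p Y

  p≤3*#small : p ≤ 3 * #small
  p≤3*#small = begin
    p                   ≡⟨ *-identityʳ p ⟨
    p * 1               ≡⟨ ∑<-const p 1 ⟨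
    ∑< p (λ _ → 1)      ≤⟨ ∑<-mono-≤ p (λ a a<p → window-has-small (s≤s⁻¹ a<p)) ⟩
    ∑< p (λ a → small (pred a) + small a + small (suc a ⊓ L)) ≡⟨ ∑<-window L small ⟩
    3 * #small          ∎
    where open ≤-Reasoning

  #large+q*#excess≤2*#deficit : #large + q * #excess ≤ 2 * #deficit
  #large+q*#excess≤2*#deficit = +-cancelʳ-≤ #deficit _ _ (begin
    #large + q * #excess + #deficit
      ≡⟨ cong (λ t → #large + t + #deficit) (∑<-*-distribˡ p q excess) ⟨
    #large + ∑< p (λ a → q * excess a) + #deficit
      ≡⟨ cong (_+ #deficit) (∑<-distrib-+ p (λ a → 1 ∸ small a) (λ a → q * excess a)) ⟨
    ∑< p (λ a → 1 ∸ small a + q * excess a) + #deficit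
      ≡⟨ ∑<-distrib-+ p (λ a → 1 ∸ small a + q * excess a) deficit ⟨
    ∑< p (λ a → 1 ∸ small a + q * excess a + deficit a)
      ≤⟨ ∑<-mono-≤ p (λ a a<p →
           ≤-trans (+-monoˡ-≤ (deficit a) (excess-bounded-by-neighbours (s≤s⁻¹ a<p)))
                   (≤-reflexive (+-right-comm (deficit (pred a)) _ _))) ⟩
    ∑< p (λ a → deficit (pred a) + deficit a + deficit (suc a ⊓ L))
      ≡⟨ ∑<-window L deficit ⟩
    3 * #deficit
      ≡⟨ +-comm #deficit (2 * #deficit) ⟩
    2 * #deficit + #deficit ∎)
    where open ≤-Reasoning

  #small≤#deficit : #small ≤ #deficit
  #small≤#deficit = ∑<-mono-≤ p (λ a _ → small≤deficit a)

  total+#deficit≡p*m+#excess : total + #deficit ≡ p * m + #excess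
  total+#deficit≡p*m+#excess = begin
    total + #deficit                ≡⟨ ∑<-distrib-+ p Y deficit ⟨
    ∑< p (λ a → Y a + deficit a)   ≡⟨ ∑<-cong p (λ a _ → m+[n∸m]≡n+[m∸n] (Y a) m) ⟩
    ∑< p (λ a → m + excess a)      ≡⟨ ∑<-distrib-+ p (λ _ → m) excess ⟩
    ∑< p (λ _ → m) + #excess       ≡⟨ cong (_+ #excess) (∑<-const p m) ⟩
    p * m + #excess                 ∎
    where open ≡-Reasoning

  #large+#small≡p : #large + #small ≡ p
  #large+#small≡p = ∑<-complement p small (λ a → 𝟙≤1 (Y a <? m))

  total+⌈p/3⌉≤p*m : 3 ≤ q → total + ⌈ p /3⌉ ≤ p * m
  total+⌈p/3⌉≤p*m 3≤q = +-cancelʳ-≤ #excess _ _ (begin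
    total + ⌈ p /3⌉ + #excess     ≡⟨ +-assoc total ⌈ p /3⌉ #excess ⟩
    total + (⌈ p /3⌉ + #excess)   ≡⟨ cong (total +_) (⌈/3⌉-+-* p #excess) ⟨
    total + ⌈ p + 3 * #excess /3⌉ ≤⟨ +-monoʳ-≤ total (⌈/3⌉-least p+3*#excess≤3*#deficit) ⟩
    total + #deficit              ≡⟨ total+#deficit≡p*m+#excess ⟩
    p * m + #excess               ∎)
    where
    open ≤-Reasoning
    p+3*#excess≤3*#deficit : p + 3 * #excess ≤ 3 * #deficit
    p+3*#excess≤3*#deficit = begin
      p + 3 * #excess                  ≡⟨ cong (_+ 3 * #excess) #large+#small≡p ⟨
      #large + #small + 3 * #excess    ≡⟨ +-right-comm #large #small _ ⟩
      #large + 3 * #excess + #small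
        ≤⟨ +-mono-≤ (+-monoʳ-≤ #large (*-monoˡ-≤ #excess 3≤q)) #small≤#deficit ⟩
      #large + q * #excess + #deficit  ≤⟨ +-monoˡ-≤ #deficit #large+q*#excess≤2*#deficit ⟩
      2 * #deficit + #deficit          ≡⟨ +-comm (2 * #deficit) #deficit ⟩
      3 * #deficit                     ∎

  deficit-pair+#small≤#deficit+2 : ∀ {u v} → u < v → v < p → deficit u + deficit v + #small ≤ #deficit + 2
  deficit-pair+#small≤#deficit+2 {u} {v} u<v v<p = begin
    deficit u + deficit v + #small
      ≤⟨ +-monoˡ-≤ #small (+-mono-≤ (deficit≤surplus+1 u) (deficit≤surplus+1 v)) ⟩
    surplus u + 1 + (surplus v + 1) + #small ≡⟨ shuffle (surplus u) (surplus v) #small ⟩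
    surplus u + surplus v + #small + 2      ≤⟨ +-monoˡ-≤ 2 (+-monoˡ-≤ #small (≤-∑<₂ surplus u<v v<p)) ⟩
    ∑< p surplus + #small + 2               ≡⟨ cong (_+ 2) (∑<-distrib-+ p surplus small) ⟨
    ∑< p (λ a → surplus a + small a) + 2    ≡⟨ cong (_+ 2) (∑<-cong p (λ a _ → deficit≡surplus+small a)) ⟨
    #deficit + 2                            ∎
    where
    open ≤-Reasoning
    surplus : ℕ → ℕ
    surplus a = deficit a ∸ small a
    deficit≡surplus+small : ∀ a → deficit a ≡ surplus a + small a
    deficit≡surplus+small a = sym (m∸n+n≡m (small≤deficit a))
    deficit≤surplus+1 : ∀ a → deficit a ≤ surplus a + 1
    deficit≤surplus+1 a =
      ≤-trans (≤-reflexive (deficit≡surplus+small a)) (+-monoʳ-≤ (surplus a) (𝟙≤1 (Y a <? m)))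
    shuffle : ∀ x y s → x + 1 + (y + 1) + s ≡ x + y + s + 2
    shuffle = solve-∀

  large-entry⇒q+#small≤#deficit+1 : ∀ {j} → j < p → m < Y j → q + #small ≤ #deficit + 1
  large-entry⇒q+#small≤#deficit+1 {j} j<p m<Yj = s≤s⁻¹ (begin
    suc (q + #small)                ≤⟨ +-monoˡ-≤ #small 1+q≤deficits ⟩
    deficit u + deficit v + #small  ≤⟨ deficit-pair+#small≤#deficit+2 u<v v<p ⟩
    #deficit + 2                    ≡⟨ +-suc #deficit 1 ⟩
    suc (#deficit + 1)              ∎)
    where
    open ≤-Reasoning
    j≤L : j ≤ L
    j≤L = s≤s⁻¹ j<p
    u v : ℕ
    u = pred j
    v = suc j ⊓ L
    u<v : u < v
    u<v = ⊓-pres-m< (≤-<-trans pred[n]≤n (n<1+n j)) (s≤s (pred-mono-≤ j≤L))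
    v<p : v < p
    v<p = s≤s (m⊓n≤n (suc j) L)
    1+q≤deficits : 1 + q ≤ deficit u + deficit v
    1+q≤deficits = begin
      1 + q                         ≡⟨ cong₂ (λ s e → 1 ∸ s + e) (small≡0 (<⇒≤ m<Yj)) (*-identityʳ q) ⟨
      1 ∸ small j + q * 1           ≤⟨ +-monoʳ-≤ (1 ∸ small j) (*-monoʳ-≤ q (m<n⇒0<n∸m m<Yj)) ⟩
      1 ∸ small j + q * excess j    ≤⟨ excess-bounded-by-neighbours j≤L ⟩
      deficit u + deficit v         ∎

  p+total≤2+p*m : 5 ≤ q → ∀ {j} → j < p → m < Y j → p + total ≤ 2 + p * m
  p+total≤2+p*m 5≤q j<p m<Yj = +-cancelʳ-≤ #deficit _ _ (begin
    p + total + #deficit          ≡⟨ +-assoc p total #deficit ⟩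
    p + (total + #deficit)        ≡⟨ cong (p +_) total+#deficit≡p*m+#excess ⟩
    p + (p * m + #excess)         ≡⟨ regroup q (p * m) #excess ⟩
    2 + p * m + (q + #excess)     ≤⟨ +-monoʳ-≤ (2 + p * m) q+#excess≤#deficit ⟩
    2 + p * m + #deficit          ∎)
    where
    open ≤-Reasoning
    regroup : ∀ q n e → 2 + q + (n + e) ≡ 2 + n + (q + e)
    regroup = solve-∀
    3≤#small : 3 ≤ #small
    3≤#small = *-cancelˡ-< 3 2 #small (≤-trans (+-monoʳ-≤ 2 5≤q) p≤3*#small)
    q+#excess≤#deficit : q + #excess ≤ #deficit
    q+#excess≤#deficit = deficit-absorbs-excess 5≤q 3≤#small #large+#small≡p
                           (large-entry⇒q+#small≤#deficit+1 j<p m<Yj) #large+q*#excess≤2*#deficit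

  module Maximum (ymax : ℕ) (Y≤ymax : ∀ {a} → a < p → Y a ≤ ymax)
                 {a₀ : ℕ} (a₀<p : a₀ < p) (Ya₀≡ymax : Y a₀ ≡ ymax) where

    maximal : ℕ → ℕ
    maximal a = 𝟙 (Y a ≟ ymax)

    #max : ℕ
    #max = ∑< p maximal

    1≤#max : 1 ≤ #max
    1≤#max = subst (_≤ #max) (𝟙-yes (Y a₀ ≟ ymax) Ya₀≡ymax) (≤-∑<₁ maximal a₀<p)

    p+total≤#max+p*m-without-excess : (∀ {a} → a < p → Y a ≤ m) → p + total ≤ #max + p * m
    p+total≤#max+p*m-without-excess Y≤m = begin
      p + total
        ≡⟨ cong (_+ total) (∑<-complement p maximal (λ a → 𝟙≤1 (Y a ≟ ymax))) ⟨
      ∑< p (λ a → 1 ∸ maximal a) + #max + total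
        ≤⟨ +-monoˡ-≤ total (+-monoˡ-≤ #max (∑<-mono-≤ p non-maximal≤deficit)) ⟩
      #deficit + #max + total                    ≡⟨ +-comm (#deficit + #max) total ⟩
      total + (#deficit + #max)                  ≡⟨ +-assoc total #deficit #max ⟨
      total + #deficit + #max                    ≡⟨ cong (_+ #max) total+#deficit≡p*m+#excess ⟩
      p * m + #excess + #max                     ≡⟨ cong (λ e → p * m + e + #max) #excess≡0 ⟩
      p * m + 0 + #max                           ≡⟨ cong (_+ #max) (+-identityʳ (p * m)) ⟩
      p * m + #max                               ≡⟨ +-comm (p * m) #max ⟩
      #max + p * m                               ∎
      where
      open ≤-Reasoning
      #excess≡0 : #excess ≡ 0
      #excess≡0 = trans (∑<-cong p (λ a a<p → m≤n⇒m∸n≡0 (Y≤m a<p))) (trans (∑<-const p 0) (*-zeroʳ p))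
      non-maximal≤deficit : ∀ a → a < p → 1 ∸ maximal a ≤ deficit a
      non-maximal≤deficit a a<p with Y a ≟ ymax
      ... | yes _     = z≤n
      ... | no Ya≢max =
        m<n⇒0<n∸m (<-≤-trans (≤∧≢⇒< (Y≤ymax a<p) Ya≢max) (subst (_≤ m) Ya₀≡ymax (Y≤m a₀<p)))

    p+total≤#max+suc[p*m] : 5 ≤ q → p + total ≤ #max + suc (p * m)
    p+total≤#max+suc[p*m] 5≤q with anyUpTo? (λ a → m <? Y a) p
    ... | yes (j , j<p , m<Yj) = ≤-trans (p+total≤2+p*m 5≤q j<p m<Yj) (+-monoˡ-≤ (suc (p * m)) 1≤#max)
    ... | no ∄j =
      ≤-trans (p+total≤#max+p*m-without-excess (λ a<p → ≮⇒≥ (λ m<Ya → ∄j (_ , a<p , m<Ya))))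
              (+-monoʳ-≤ #max (n≤1+n (p * m)))

extend : ∀ {n} → (Fin n → ℕ) → ℕ → ℕ
extend {zero}  x _       = 0
extend {suc n} x zero    = x fzero
extend {suc n} x (suc a) = extend (x ∘′ fsuc) a

extend-toℕ : ∀ {n} (x : Fin n → ℕ) (i : Fin n) → extend x (toℕ i) ≡ x i
extend-toℕ x fzero    = refl
extend-toℕ x (fsuc i) = extend-toℕ (x ∘′ fsuc) i

extend-≤ : ∀ {n} {x : Fin n → ℕ} {c} → (∀ i → x i ≤ c) → ∀ a → extend x a ≤ c
extend-≤ {zero}  x≤c _       = z≤n
extend-≤ {suc n} x≤c zero    = x≤c fzero
extend-≤ {suc n} {x} x≤c (suc a) = extend-≤ {x = x ∘′ fsuc} (λ i → x≤c (fsuc i)) a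

∑-cong : ∀ n {f g : Fin n → ℕ} → (∀ i → f i ≡ g i) → ∑ n f ≡ ∑ n g
∑-cong zero    f≗g = refl
∑-cong (suc n) f≗g = cong₂ _+_ (f≗g fzero) (∑-cong n (λ i → f≗g (fsuc i)))

∑≡∑<-extend : ∀ {n} (x : Fin n → ℕ) → ∑ n x ≡ ∑< n (extend x)
∑≡∑<-extend x = ∑-cong _ (λ i → sym (extend-toℕ x i))

count≡∑<-extend : ∀ {n} (x : Fin n → ℕ) {P : ℕ → Set} (P? : ∀ y → Dec (P y)) →
  count n (λ i → P? (x i)) ≡ ∑< n (λ a → 𝟙 (P? (extend x a)))
count≡∑<-extend x P? = ∑-cong _ (λ i → cong (λ y → 𝟙 (P? y)) (sym (extend-toℕ x i)))

padded-row≤Mx : ∀ q (x : Fin (2 + q) → ℕ) {a} (a≤1+q : a ≤ suc q) →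
  extend x (pred a) + q * extend x a + extend x (suc a ⊓ suc q) ≤ Mx (2 + q) x (fromℕ< (s≤s a≤1+q))
padded-row≤Mx q x {a} a≤1+q = ≤-trans (padded-row≤tridiag-row q (extend x) a≤1+q) (≤-reflexive (sym (begin
  Mx (2 + q) x i
    ≡⟨ ∑-cong (2 + q) (λ j → cong₂ _*_ (M≡tridiag (2 + q) i j) (sym (extend-toℕ x j))) ⟩
  ∑< (2 + q) (λ b → tridiag (2 + q) (toℕ i) b * extend x b)
    ≡⟨ cong (λ t → ∑< (2 + q) (λ b → tridiag (2 + q) t b * extend x b)) (toℕ-fromℕ< (s≤s a≤1+q)) ⟩
  ∑< (2 + q) (λ b → tridiag (2 + q) a b * extend x b) ∎)))
  where
  open ≡-Reasoning
  i : Fin (2 + q)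
  i = fromℕ< (s≤s a≤1+q)

maxF-≤ : ∀ n (f : Fin n → ℕ) i → f i ≤ maxF n f
maxF-≤ (suc n) f fzero    = m≤m⊔n (f fzero) _
maxF-≤ (suc n) f (fsuc i) = ≤-trans (maxF-≤ n (f ∘′ fsuc) i) (m≤n⊔m (f fzero) _)

maxF-attained : ∀ n (f : Fin (suc n) → ℕ) → ∃ λ i → f i ≡ maxF (suc n) f
maxF-attained zero    f = fzero , sym (⊔-identityʳ (f fzero))
maxF-attained (suc n) f with ≤-total (maxF (suc n) (f ∘′ fsuc)) (f fzero)
... | inj₁ max≤f₀ = fzero , sym (m≥n⇒m⊔n≡m max≤f₀)
... | inj₂ f₀≤max with i , fi≡max ← maxF-attained n (f ∘′ fsuc) =
  fsuc i , trans fi≡max (sym (m≤n⇒m⊔n≡n f₀≤max))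

*≤pred⇔< : ∀ {p N m y} .{{_ : NonZero p}} → suc N ≡ p * m → p * y ≤ N ⇔ y < m
*≤pred⇔< {p} {N} {m} {y} 1+N≡pm = mk⇔
  (λ py≤N → *-cancelˡ-< p y m (subst (p * y <_) 1+N≡pm (s≤s py≤N)))
  (λ y<m → s≤s⁻¹ (subst (p * y <_) (sym 1+N≡pm) (*-monoʳ-< p y<m)))

m+n≤1+o⇒m≤o∸n+2 : ∀ {m n o} → m + n ≤ suc o → m ≤ (o ∸ n) + 2
m+n≤1+o⇒m≤o∸n+2 {m} {n} {o} m+n≤1+o = ≤-trans (+-cancelʳ-≤ n m _ (begin
  m + n               ≤⟨ m+n≤1+o ⟩
  suc o               ≤⟨ s≤s (m≤n+m∸n o n) ⟩
  suc (n + (o ∸ n))   ≡⟨ +-comm (suc n) (o ∸ n) ⟩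
  o ∸ n + suc n       ≡⟨ +-suc (o ∸ n) n ⟩
  suc (o ∸ n) + n     ∎)) (≤-trans (n≤1+n _) (≤-reflexive (+-comm 2 (o ∸ n))))
  where open ≤-Reasoning

-- Imported only here: in scope, the constructor +_ makes sections such as (n +_) ambiguous.
open import Data.Integer using (ℤ; +_; +≤+) renaming (_+_ to _+ℤ_; _-_ to _-ℤ_; -_ to negℤ; _≤_ to _≤ℤ_)
import Data.Integer.Properties as ℤ
open import Data.Integer.Tactic.RingSolver using () renaming (solve-∀ to ℤ-solve-∀)

P+S≤C+[2+N]⇒P-k-2≤C : ∀ {P S N C} (k : ℤ) → + S ≡ + N -ℤ k → P + S ≤ C + suc (suc N) →
                      (+ P -ℤ k) -ℤ + 2 ≤ℤ + C
P+S≤C+[2+N]⇒P-k-2≤C {P} {S} {N} {C} k S≡N-k P+S≤C+2+N = begin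
  (+ P -ℤ k) -ℤ + 2                  ≡⟨ cong (λ t → (+ P -ℤ t) -ℤ + 2) k≡N-S ⟩
  (+ P -ℤ (+ N -ℤ + S)) -ℤ + 2       ≡⟨ regroup (+ P) (+ S) (+ N) ⟩
  (+ P +ℤ + S) -ℤ (+ 2 +ℤ + N)        ≤⟨ ℤ.+-monoˡ-≤ (negℤ (+ 2 +ℤ + N)) (+≤+ P+S≤C+2+N) ⟩
  (+ C +ℤ (+ 2 +ℤ + N)) -ℤ (+ 2 +ℤ + N) ≡⟨ cancel (+ C) (+ 2 +ℤ + N) ⟩
  + C                                ∎
  where
  open ℤ.≤-Reasoning
  k≡N-S : k ≡ + N -ℤ + S
  k≡N-S = trans (sym (double-neg (+ N) k)) (cong ((+ N) -ℤ_) (sym S≡N-k))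
    where
    double-neg : ∀ n k → n -ℤ (n -ℤ k) ≡ k
    double-neg = ℤ-solve-∀
  regroup : ∀ P S N → (P -ℤ (N -ℤ S)) -ℤ + 2 ≡ (P +ℤ S) -ℤ (+ 2 +ℤ N)
  regroup = ℤ-solve-∀
  cancel : ∀ C T → (C +ℤ T) -ℤ T ≡ C
  cancel = ℤ-solve-∀

module FromRowBounds (q : ℕ) (x : Fin (2 + q) → ℕ) {N m : ℕ} (1+N≡p*m : suc N ≡ (2 + q) * m)
                     (Mx≤N : ∀ i → Mx (2 + q) x i ≤ N) where

  private
    p : ℕ
    p = 2 + q

  row : ∀ {a} → a ≤ suc q → extend x (pred a) + q * extend x a + extend x (suc a ⊓ suc q) < p * m
  row a≤1+q = <-≤-trans (s≤s (≤-trans (padded-row≤Mx q x a≤1+q) (Mx≤N (fromℕ< (s≤s a≤1+q)))))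
                        (≤-reflexive 1+N≡p*m)

  open TridiagonalBounds q m (extend x) row

  ⌈p/3⌉≤count-small : ⌈ p /3⌉ ≤ count p (λ i → p * x i ≤? N)
  ⌈p/3⌉≤count-small = subst (⌈ p /3⌉ ≤_) (sym count-small≡#small) (⌈/3⌉-least p≤3*#small)
    where
    count-small≡#small : count p (λ i → p * x i ≤? N) ≡ #small
    count-small≡#small = trans (count≡∑<-extend x (λ y → p * y ≤? N))
      (∑<-cong p (λ a _ → 𝟙-cong (*≤pred⇔< {p} 1+N≡p*m) (p * extend x a ≤? N) (extend x a <? m)))

  ∑≤N∸⌈p/3⌉+2 : 3 ≤ q → ∑ p x ≤ (N ∸ ⌈ p /3⌉) + 2
  ∑≤N∸⌈p/3⌉+2 3≤q = m+n≤1+o⇒m≤o∸n+2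
    (subst₂ (λ s t → s + ⌈ p /3⌉ ≤ t) (sym (∑≡∑<-extend x)) (sym 1+N≡p*m) (total+⌈p/3⌉≤p*m 3≤q))

  p-k-2≤count-max : 5 ≤ q → ∀ k → + ∑ p x ≡ + N -ℤ k →
                    (+ p -ℤ k) -ℤ + 2 ≤ℤ + count p (λ i → x i ≟ maxF p x)
  p-k-2≤count-max 5≤q k ∑≡N-k = P+S≤C+[2+N]⇒P-k-2≤C k ∑≡N-k
    (subst₂ (λ s c → p + s ≤ c + suc (suc N))
            (sym (∑≡∑<-extend x)) (sym (count≡∑<-extend x (λ y → y ≟ maxF p x)))
            (subst (λ t → p + total ≤ #max + suc t) (sym 1+N≡p*m) (p+total≤#max+suc[p*m] 5≤q)))
    where
    i₀ : Fin p
    i₀ = proj₁ (maxF-attained (suc q) x)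
    open Maximum (maxF p x) (λ {a} _ → extend-≤ (maxF-≤ p x) a) (toℕ<n i₀)
                 (trans (extend-toℕ x i₀) (proj₂ (maxF-attained (suc q) x)))

theorem3p4 : (p : ℕ) → Prime p → 7 ≤ p → (x : Fin p → ℕ)
    → (∀ i → Mx p x i ≤ (p ∸ 1) !)
    → (⌈ p /3⌉ ≤ count p (λ i → p * x i ≤? (p ∸ 1) !))
      × (∀ (k : ℤ) → + ∑ p x ≡ + ((p ∸ 1) !) -ℤ k
          → (+ p -ℤ k) -ℤ + 2 ≤ℤ + count p (λ i → x i ≟ maxF p x))
      × (∑ p x ≤ ((p ∸ 1) ! ∸ ⌈ p /3⌉) + 2)
theorem3p4 p p-prime 7≤p x Mx≤[p∸1]! with p ∸ 7 | m+[n∸m]≡n 7≤p | wilson p-prime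
... | k | refl | divides m 1+[p∸1]!≡m*p =
  ⌈p/3⌉≤count-small , p-k-2≤count-max (m≤m+n 5 k) , ∑≤N∸⌈p/3⌉+2 (m≤m+n 3 (2 + k))
  where open FromRowBounds (5 + k) x {m = m} (trans 1+[p∸1]!≡m*p (*-comm m p)) Mx≤[p∸1]!
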